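{- Let $n \geq 1$ and let $G$ be the sibling tree $ST_n$. Then the domination number of $G$ is $$\gamma(G) = \begin{cases} \frac{1}{7}(2^{n+2}+3) & \text{if } n\equiv 0 \pmod 3,\\ \frac{1}{7}(2^{n+2}-1) & \text{if } n\equiv 1 \pmod 3,\\ \frac{2}{7}(2^{n+1}-1) & \text{if } n\equiv 2 \pmod 3.\end{cases}$$
   Context: The sibling tree $ST_n$ has vertex set $\{1,2,\dots,2^{n+1}-1\}$; its edges are the edges of the complete binary tree of height $n$ in which vertex $x$ has children $2x$ and $2x+1$ (root $1$ at level $0$; vertex $v$ is at level $i$ iff $2^i\le v\le 2^{i+1}-1$), together with the sibling edges $\{2x,2x+1\}$ for every $x$ with $1\le x\le 2^n-1$. A set $S\subseteq V(G)$ is dominating if every vertex of $V(G)\setminus S$ is adjacent to some vertex of $S$; $\gamma(G)$ is the minimum cardinality of a dominating set. -}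

module Defs where

open import Data.Nat using (ℕ; zero; suc; _+_; _*_; _^_; _≤_; _<_; _∸_)
open import Data.Nat.DivMod using (_%_; _/_)
open import Data.Product using (_×_; Σ; ∃)
open import Data.Sum using (_⊎_)
open import Data.List using (List; length)
open import Data.List.Membership.Propositional using (_∈_)
open import Data.List.Relation.Unary.All using (All)
open import Data.List.Relation.Unary.Unique.Propositional using (Unique)
open import Relation.Binary.PropositionalEquality using (_≡_)

IsVertex : ℕ → ℕ → Set
IsVertex n v = 1 ≤ v × v < 2 ^ (suc n)

-- Edges of ST_n (on vertices): tree edges {x,2x},{x,2x+1} and
-- sibling edges {2x,2x+1} for 1 ≤ x ≤ 2^n - 1.
-- Within the vertex set these are exactly the edges below
-- (for vertices u,v of ST_n, a tree/sibling relation forces x in range).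
data Edge (n : ℕ) : ℕ → ℕ → Set where
  tree-l  : ∀ x → 1 ≤ x → x < 2 ^ n → Edge n x (2 * x)
  tree-r  : ∀ x → 1 ≤ x → x < 2 ^ n → Edge n x (suc (2 * x))
  sibling : ∀ x → 1 ≤ x → x < 2 ^ n → Edge n (2 * x) (suc (2 * x))

Adj : ℕ → ℕ → ℕ → Set
Adj n u v = Edge n u v ⊎ Edge n v u

IsDominating : ℕ → List ℕ → Set
IsDominating n S =
  All (IsVertex n) S ×
  (∀ v → IsVertex n v → v ∈ S ⊎ ∃ λ u → u ∈ S × Adj n u v)

DominationNumber : ℕ → ℕ → Set
DominationNumber n k =
  (∃ λ S → IsDominating n S × Unique S × length S ≡ k) ×
  (∀ S → IsDominating n S → Unique S → k ≤ length S)

module Submission where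

-- Let γ 0 = γ 1 = 1, γ 2 = 2 and γ (k+3) = 2^(k+2) + γ k.  We prove that γ n is the
-- domination number of ST_n, and that 7·γ n + c = 2^(n+2) + 3 where the offset c is 0, 4, 5
-- according as n ≡ 0, 1, 2 (mod 3); the three cases of the theorem are read off from this.
--
-- Lower bound, by induction n ↦ n + 3.  Let S dominate ST_(k+3).
--  * A dominator of a leaf 2x (x on level k+2) lies in {x, 2x, 2x+1}.  Replacing vertices
--    of level k+3 by their parents, these dominators cover level k+2, so by the pigeonhole
--    principle S has at least 2^(k+2) vertices on levels k+2 and k+3.
--  * The vertices of S on levels ≤ k+1, with those of level k+1 replaced by their parents,
--    dominate ST_k, so there are at least γ k of them.
-- Upper bound: level k+2 dominates levels k+1, k+2, k+3 of ST_(k+3); together with the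
-- optimal dominating set of ST_k this gives a dominating set of size γ (k+3).

open import Defs
open import Data.Nat using (ℕ; zero; suc; _+_; _*_; _∸_; _^_; _≤_; _<_; z≤n; s≤s; ⌊_/2⌋; _≤?_; _<?_)
open import Data.Nat.DivMod using (_%_; [m+n]%n≡m%n)
open import Data.Nat.Properties
open import Data.Nat.Tactic.RingSolver using (solve-∀)
open import Data.Bool using (true; false)
open import Data.Empty using (⊥-elim)
open import Data.Product using (_×_; ∃; _,_; proj₁; proj₂)
open import Data.Sum using (_⊎_; inj₁; inj₂)
open import Data.List using (List; []; _∷_; length; map; filter; applyUpTo; _++_)
open import Data.List.Properties using (length-map; length-++; length-applyUpTo; length-filter)
open import Data.List.Membership.Propositional using (_∈_)
open import Data.List.Membership.Propositional.Properties using (∈-map⁺; ∈-++⁺ˡ; ∈-++⁺ʳ; ∈-++⁻; ∈-∃++; ∈-filter⁺; ∈-applyUpTo⁺; ∈-applyUpTo⁻)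
open import Data.List.Relation.Binary.Subset.Propositional using (_⊆_)
open import Data.List.Relation.Binary.Disjoint.Propositional using (Disjoint)
open import Data.List.Relation.Unary.Any using (here; there)
open import Data.List.Relation.Unary.All using (All; lookup; tabulate)
import Data.List.Relation.Unary.All as All
import Data.List.Relation.Unary.All.Properties as All
open import Data.List.Relation.Unary.AllPairs using (_∷_)
open import Data.List.Relation.Unary.Unique.Propositional using (Unique)
import Data.List.Relation.Unary.Unique.Propositional.Properties as Unique
open import Relation.Binary.PropositionalEquality
open import Relation.Nullary using (yes; no; does)
open import Relation.Unary using (Decidable)
open import Relation.Unary.Properties using (∁?)

-- Halving.  ⌊ v /2⌋ is the parent of vertex v, and 2v, 2v+1 are its children.

-- Doubling in the shape x + x used by the library's halving lemmas.
double≡+ : ∀ t → 2 * t ≡ t + t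
double≡+ t = cong (t +_) (+-identityʳ t)

half-double : ∀ x → ⌊ 2 * x /2⌋ ≡ x
half-double x = sym (trans (n≡⌊n+n/2⌋ x) (cong ⌊_/2⌋ (sym (double≡+ x))))

half-double+1 : ∀ x → ⌊ suc (2 * x) /2⌋ ≡ x
half-double+1 zero    = refl
half-double+1 (suc x) = cong suc (trans (cong ⌊_/2⌋ (+-suc x (x + 0))) (half-double+1 x))

parity : ∀ v → v ≡ 2 * ⌊ v /2⌋ ⊎ v ≡ suc (2 * ⌊ v /2⌋)
parity zero          = inj₁ refl
parity (suc zero)    = inj₂ refl
parity (suc (suc v)) with parity v
... | inj₁ e = inj₁ (trans (cong (λ t → suc (suc t)) e) (sym (*-suc 2 ⌊ v /2⌋)))
... | inj₂ e = inj₂ (trans (cong (λ t → suc (suc t)) e) (sym (cong suc (*-suc 2 ⌊ v /2⌋))))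

≤-half⁺ : ∀ {t v} → 2 * t ≤ v → t ≤ ⌊ v /2⌋
≤-half⁺ {t} 2t≤v = subst (_≤ _) (half-double t) (⌊n/2⌋-mono 2t≤v)

half-<⁺ : ∀ {t v} → v < 2 * t → ⌊ v /2⌋ < t
half-<⁺ {t} v<2t = subst (_ <_) (half-double+1 t) (⌊n/2⌋-mono (s≤s v<2t))

≤-half⁻ : ∀ {t v} → t ≤ ⌊ v /2⌋ → 2 * t ≤ v
≤-half⁻ t≤h = ≮⇒≥ (λ v<2t → <⇒≱ (half-<⁺ v<2t) t≤h)

half-<⁻ : ∀ {t v} → ⌊ v /2⌋ < t → v < 2 * t
half-<⁻ h<t = ≰⇒> (λ 2t≤v → <⇒≱ h<t (≤-half⁺ 2t≤v))

-- contract t u keeps u if u < t and otherwise replaces it by its parent; for t = 2^(i+1)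
-- it moves the vertices of level i+1 onto level i.
contract : ℕ → ℕ → ℕ
contract t u with u <? t
... | yes _ = u
... | no _  = ⌊ u /2⌋

contract-< : ∀ {t u} → u < t → contract t u ≡ u
contract-< {t} {u} u<t with u <? t
... | yes _  = refl
... | no u≮t = ⊥-elim (u≮t u<t)

contract-≥ : ∀ {t u} → t ≤ u → contract t u ≡ ⌊ u /2⌋
contract-≥ {t} {u} t≤u with u <? t
... | yes u<t = ⊥-elim (<⇒≱ u<t t≤u)
... | no _    = refl

unique-⊆⇒length≤ : ∀ {A : Set} {U L : List A} → Unique U → U ⊆ L → length U ≤ length L
unique-⊆⇒length≤ {U = []}    _              _    = z≤n
unique-⊆⇒length≤ {U = u ∷ U} (u∉U ∷ unique) U⊆L with ∈-∃++ (U⊆L (here refl))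
... | ys , zs , refl = begin
    suc (length U)           ≤⟨ s≤s (unique-⊆⇒length≤ unique U⊆ys++zs) ⟩
    suc (length (ys ++ zs))  ≡⟨ cong suc (length-++ ys) ⟩
    suc (length ys + length zs) ≡⟨ sym (+-suc (length ys) (length zs)) ⟩
    length ys + suc (length zs) ≡⟨ sym (length-++ ys) ⟩
    length (ys ++ u ∷ zs)    ∎
  where
  open ≤-Reasoning
  U⊆ys++zs : U ⊆ ys ++ zs
  U⊆ys++zs x∈U with ∈-++⁻ ys (U⊆L (there x∈U))
  ... | inj₁ x∈ys         = ∈-++⁺ˡ x∈ys
  ... | inj₂ (here x≡u)   = ⊥-elim (lookup u∉U x∈U (sym x≡u))
  ... | inj₂ (there x∈zs) = ∈-++⁺ʳ ys x∈zs

length-filter+filter-∁ : ∀ {A : Set} {P : A → Set} (P? : Decidable P) xs →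
                         length (filter P? xs) + length (filter (∁? P?) xs) ≡ length xs
length-filter+filter-∁ P? []       = refl
length-filter+filter-∁ P? (x ∷ xs) with does (P? x)
... | true  = cong suc (length-filter+filter-∁ P? xs)
... | false = trans (+-suc _ _) (cong suc (length-filter+filter-∁ P? xs))

-- Levels.  Level i of the tree is the interval [2^i, 2^(i+1)), of size 2^i.

level : ℕ → List ℕ
level i = applyUpTo (2 ^ i +_) (2 ^ i)

level-unique : ∀ i → Unique (level i)
level-unique i = Unique.applyUpTo⁺₁ (2 ^ i +_) (2 ^ i) (λ j<j′ _ → <⇒≢ (+-monoʳ-< (2 ^ i) j<j′))

∈-level⁻ : ∀ i {v} → v ∈ level i → 2 ^ i ≤ v × v < 2 ^ suc i
∈-level⁻ i v∈ with ∈-applyUpTo⁻ (2 ^ i +_) v∈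
... | j , j<2^i , refl = m≤m+n (2 ^ i) j ,
                         subst (2 ^ i + j <_) (sym (double≡+ (2 ^ i))) (+-monoʳ-< (2 ^ i) j<2^i)

∈-level⁺ : ∀ i {v} → 2 ^ i ≤ v → v < 2 ^ suc i → v ∈ level i
∈-level⁺ i {v} 2^i≤v v<2^i+1 = subst (_∈ level i) (m+[n∸m]≡n 2^i≤v)
  (∈-applyUpTo⁺ (2 ^ i +_) (+-cancelˡ-< (2 ^ i) _ _ offset<))
  where
  offset< : 2 ^ i + (v ∸ 2 ^ i) < 2 ^ i + 2 ^ i
  offset< = subst₂ _<_ (sym (m+[n∸m]≡n 2^i≤v)) (double≡+ (2 ^ i)) v<2^i+1

level-vertices : ∀ i n → i ≤ n → All (IsVertex n) (level i)
level-vertices i n i≤n = tabulate λ v∈ →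
  ≤-trans (m^n>0 2 i) (proj₁ (∈-level⁻ i v∈)) ,
  <-≤-trans (proj₂ (∈-level⁻ i v∈)) (^-monoʳ-≤ 2 (s≤s i≤n))

-- Adjacency.  Edges of ST_m persist in ST_n for n ≥ m, and an edge of ST_n between two
-- vertices of ST_m is already an edge of ST_m (ST_m is an induced subgraph of ST_n).

Edge-mono : ∀ {m n u v} → m ≤ n → Edge m u v → Edge n u v
Edge-mono m≤n (tree-l x 1≤x x<2^m)  = tree-l x 1≤x (<-≤-trans x<2^m (^-monoʳ-≤ 2 m≤n))
Edge-mono m≤n (tree-r x 1≤x x<2^m)  = tree-r x 1≤x (<-≤-trans x<2^m (^-monoʳ-≤ 2 m≤n))
Edge-mono m≤n (sibling x 1≤x x<2^m) = sibling x 1≤x (<-≤-trans x<2^m (^-monoʳ-≤ 2 m≤n))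

Adj-mono : ∀ {m n u v} → m ≤ n → Adj m u v → Adj n u v
Adj-mono m≤n (inj₁ e) = inj₁ (Edge-mono m≤n e)
Adj-mono m≤n (inj₂ e) = inj₂ (Edge-mono m≤n e)

-- The larger endpoint of an edge bounds the parameter x of the edge.
Edge-restrict : ∀ {m n u v} → Edge n u v → v < 2 ^ suc m → Edge m u v
Edge-restrict (tree-l x 1≤x _)  v<  = tree-l x 1≤x (*-cancelˡ-< 2 _ _ v<)
Edge-restrict (tree-r x 1≤x _)  v<  = tree-r x 1≤x (*-cancelˡ-< 2 _ _ (<-trans (n<1+n _) v<))
Edge-restrict (sibling x 1≤x _) v<  = sibling x 1≤x (*-cancelˡ-< 2 _ _ (<-trans (n<1+n _) v<))

Adj-restrict : ∀ {m n u v} → Adj n u v → u < 2 ^ suc m → v < 2 ^ suc m → Adj m u v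
Adj-restrict (inj₁ e) _  v< = inj₁ (Edge-restrict e v<)
Adj-restrict (inj₂ e) u< _  = inj₂ (Edge-restrict e u<)

-- The three ways in which u can be adjacent to v: as its parent, as a child (v is then not
-- a leaf), or as its sibling.
data Adjacency (n u v : ℕ) : Set where
  parent-of  : u ≡ ⌊ v /2⌋ → Adjacency n u v
  child-of   : v ≡ ⌊ u /2⌋ → v < 2 ^ n → Adjacency n u v
  sibling-of : ⌊ u /2⌋ ≡ ⌊ v /2⌋ → Adjacency n u v

classify : ∀ {n u v} → Adj n u v → Adjacency n u v
classify (inj₁ (tree-l x _ _))    = parent-of (sym (half-double x))
classify (inj₁ (tree-r x _ _))    = parent-of (sym (half-double+1 x))
classify (inj₁ (sibling x _ _))   = sibling-of (trans (half-double x) (sym (half-double+1 x)))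
classify (inj₂ (tree-l x _ x<2^n)) = child-of (sym (half-double x)) x<2^n
classify (inj₂ (tree-r x _ x<2^n)) = child-of (sym (half-double+1 x)) x<2^n
classify (inj₂ (sibling x _ _))   = sibling-of (trans (half-double+1 x) (sym (half-double x)))

parent-adjacent : ∀ {n v} → 2 ≤ v → v < 2 ^ suc n → Adj n ⌊ v /2⌋ v
parent-adjacent {n} {v} 2≤v v<2^n+1 with parity v
... | inj₁ e = subst (Adj n ⌊ v /2⌋) (sym e) (inj₁ (tree-l _ (≤-half⁺ 2≤v) (half-<⁺ v<2^n+1)))
... | inj₂ e = subst (Adj n ⌊ v /2⌋) (sym e) (inj₁ (tree-r _ (≤-half⁺ 2≤v) (half-<⁺ v<2^n+1)))

Dominated : ℕ → List ℕ → ℕ → Set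
Dominated n S v = v ∈ S ⊎ ∃ λ u → u ∈ S × Adj n u v

Dominates : ℕ → List ℕ → Set
Dominates n S = ∀ v → IsVertex n v → Dominated n S v

Dominated-mono : ∀ {m n S S′ v} → m ≤ n → S ⊆ S′ → Dominated m S v → Dominated n S′ v
Dominated-mono _   S⊆S′ (inj₁ v∈S)             = inj₁ (S⊆S′ v∈S)
Dominated-mono m≤n S⊆S′ (inj₂ (u , u∈S , adj)) = inj₂ (u , S⊆S′ u∈S , Adj-mono m≤n adj)

dominated⇒nonempty : ∀ {n S v} → Dominated n S v → 1 ≤ length S
dominated⇒nonempty {S = _ ∷ _} _                  = s≤s z≤n
dominated⇒nonempty {S = []}    (inj₁ ())
dominated⇒nonempty {S = []}    (inj₂ (_ , () , _))

k≤k+3 : ∀ k → k ≤ suc (suc (suc k))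
k≤k+3 k = m≤n+m k 3

γ : ℕ → ℕ
γ zero                = 1
γ (suc zero)          = 1
γ (suc (suc zero))    = 2
γ (suc (suc (suc k))) = 2 ^ suc (suc k) + γ k

-- Lower bound.  The vertices of S at or below, resp. above, the level starting at t.

deep shallow : ℕ → List ℕ → List ℕ
deep t    = filter (t ≤?_)
shallow t = filter (∁? (t ≤?_))

leaf-neighbourhood : ∀ {m S x} → 2 ^ m ≤ x → Dominated (suc m) S (2 * x) →
                     ∃ λ s → s ∈ S × (s ≡ x ⊎ ⌊ s /2⌋ ≡ x)
leaf-neighbourhood {x = x} _ (inj₁ 2x∈S) = 2 * x , 2x∈S , inj₂ (half-double x)
leaf-neighbourhood {x = x} 2^m≤x (inj₂ (u , u∈S , adj)) with classify adj
... | parent-of u≡   = u , u∈S , inj₁ (trans u≡ (half-double x))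
... | child-of _ 2x< = ⊥-elim (<⇒≱ 2x< (*-monoʳ-≤ 2 2^m≤x))
... | sibling-of e   = u , u∈S , inj₂ (trans e (half-double x))

leaf-dominator : ∀ {m S x} → 2 ^ m ≤ x → x < 2 ^ suc m → Dominates (suc m) S →
                 ∃ λ s → s ∈ S × 2 ^ m ≤ s × contract (2 ^ suc m) s ≡ x
leaf-dominator {m} {x = x} 2^m≤x x< dom
  with leaf-neighbourhood 2^m≤x (dom (2 * x) (≤-trans (m^n>0 2 m) (≤-trans 2^m≤x (m≤m+n x _)) ,
                                              *-monoʳ-< 2 x<))
... | s , s∈S , inj₁ refl = s , s∈S , 2^m≤x , contract-< x<
... | s , s∈S , inj₂ e    =
  s , s∈S , ≤-trans 2^m≤x (subst (_≤ s) e (⌊n/2⌋≤n s)) ,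
  trans (contract-≥ (≤-half⁻ (subst (2 ^ m ≤_) (sym e) 2^m≤x))) e

deep-part-large : ∀ m S → Dominates (suc m) S → 2 ^ m ≤ length (deep (2 ^ m) S)
deep-part-large m S dom = begin
  2 ^ m                                               ≡⟨ sym (length-applyUpTo _ (2 ^ m)) ⟩
  length (level m)                                    ≤⟨ unique-⊆⇒length≤ (level-unique m) covered ⟩
  length (map (contract (2 ^ suc m)) (deep (2 ^ m) S)) ≡⟨ length-map _ (deep (2 ^ m) S) ⟩
  length (deep (2 ^ m) S)                             ∎
  where
  open ≤-Reasoning
  covered : level m ⊆ map (contract (2 ^ suc m)) (deep (2 ^ m) S)
  covered {x} x∈level with ∈-level⁻ m x∈level
  ... | 2^m≤x , x< with leaf-dominator 2^m≤x x< dom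
  ...   | s , s∈S , 2^m≤s , s↦x =
    subst (_∈ _) s↦x (∈-map⁺ (contract (2 ^ suc m)) (∈-filter⁺ (2 ^ m ≤?_) s∈S 2^m≤s))

shallow-part-dominates : ∀ k S → Dominates (suc (suc (suc k))) S →
  Dominates k (map (contract (2 ^ suc k)) (shallow (2 ^ suc (suc k)) S))
shallow-part-dominates k S dom v (1≤v , v<N) = project (dom v (1≤v , v<2^k+4))
  where
  N = 2 ^ suc k
  L = map (contract N) (shallow (2 * N) S)
  v<2^k+4 : v < 2 ^ suc (suc (suc (suc k)))
  v<2^k+4 = <-≤-trans v<N (^-monoʳ-≤ 2 (s≤s (k≤k+3 k)))
  kept : ∀ {u} → u ∈ S → u < 2 * N → contract N u ∈ L
  kept u∈S u<2N = ∈-map⁺ (contract N) (∈-filter⁺ (∁? ((2 * N) ≤?_)) u∈S (<⇒≱ u<2N))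
  -- a dominator u of v below level k+1 can only be a child of v, contracted onto v itself
  project : Dominated (suc (suc (suc k))) S v → Dominated k L v
  project (inj₁ v∈S) = inj₁ (subst (_∈ L) (contract-< v<N) (kept v∈S (<-≤-trans v<N (m≤m+n N _))))
  project (inj₂ (u , u∈S , adj)) with u <? N
  ... | yes u<N = inj₂ (u , subst (_∈ L) (contract-< u<N) (kept u∈S (<-≤-trans u<N (m≤m+n N _))) ,
                        Adj-restrict adj u<N v<N)
  ... | no u≮N with classify adj
  ...   | parent-of u≡ = ⊥-elim (u≮N (≤-<-trans (subst (_≤ v) (sym u≡) (⌊n/2⌋≤n v)) v<N))
  ...   | child-of v≡ _ = inj₁ (subst (_∈ L) (trans (contract-≥ (≮⇒≥ u≮N)) (sym v≡))
                                  (kept u∈S (half-<⁻ (subst (_< N) v≡ v<N))))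
  ...   | sibling-of e = ⊥-elim (<⇒≱ (half-<⁺ v<N) (subst (2 ^ k ≤_) e (≤-half⁺ (≮⇒≥ u≮N))))

-- Lower bound: every dominating set of ST_n has at least γ n vertices.  A dominating set of
-- ST_(k+3) splits into its part on levels ≥ k+2 and its part above, bounded separately.
γ-lower : ∀ n S → Dominates n S → γ n ≤ length S
γ-lower zero S dom             = dominated⇒nonempty (dom 1 (≤-refl , s≤s (s≤s z≤n)))
γ-lower (suc zero) S dom       = ≤-trans (deep-part-large 0 S dom) (length-filter _ S)
γ-lower (suc (suc zero)) S dom = ≤-trans (deep-part-large 1 S dom) (length-filter _ S)
γ-lower (suc (suc (suc k))) S dom = begin
  2 ^ suc (suc k) + γ k                  ≤⟨ +-mono-≤ (deep-part-large (suc (suc k)) S dom) shallow-bound ⟩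
  length (deep T S) + length (shallow T S) ≡⟨ length-filter+filter-∁ (T ≤?_) S ⟩
  length S                               ∎
  where
  open ≤-Reasoning
  T = 2 ^ suc (suc k)
  shallow-bound : γ k ≤ length (shallow T S)
  shallow-bound = subst (γ k ≤_) (length-map _ (shallow T S))
                    (γ-lower k _ (shallow-part-dominates k S dom))

-- Upper bound.  Level j of ST_n (j ≤ n) dominates every vertex on levels j-1, j and j+1.
level-dominates : ∀ n j {v} → j ≤ n → IsVertex n v → 2 ^ j ≤ 2 * v → v < 2 ^ suc (suc j) →
                  Dominated n (level j) v
level-dominates n j {v} j≤n (1≤v , v<2^n+1) 2^j≤2v v<2^j+2 with 2 ^ suc j ≤? v | 2 ^ j ≤? v
... | yes below | _ =
  inj₂ (⌊ v /2⌋ , ∈-level⁺ j (≤-half⁺ below) (half-<⁺ v<2^j+2) ,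
        parent-adjacent (≤-trans (*-monoʳ-≤ 2 (m^n>0 2 j)) below) v<2^n+1)
... | no within | yes on = inj₁ (∈-level⁺ j on (≰⇒> within))
... | no _      | no above =
  inj₂ (2 * v , ∈-level⁺ j 2^j≤2v (*-monoʳ-< 2 (≰⇒> above)) ,
        inj₂ (tree-l v 1≤v (<-≤-trans (≰⇒> above) (^-monoʳ-≤ 2 j≤n))))

witness : ℕ → List ℕ
witness zero                = level 0
witness (suc zero)          = level 0
witness (suc (suc zero))    = level 1
witness (suc (suc (suc k))) = level (suc (suc k)) ++ witness k

witness-length : ∀ n → length (witness n) ≡ γ n
witness-length zero                = refl
witness-length (suc zero)          = refl
witness-length (suc (suc zero))    = refl
witness-length (suc (suc (suc k))) = trans (length-++ (level (suc (suc k))))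
  (cong₂ _+_ (length-applyUpTo _ (2 ^ suc (suc k))) (witness-length k))

witness-vertices : ∀ n → All (IsVertex n) (witness n)
witness-vertices zero                = level-vertices 0 0 z≤n
witness-vertices (suc zero)          = level-vertices 0 1 z≤n
witness-vertices (suc (suc zero))    = level-vertices 1 2 (s≤s z≤n)
witness-vertices (suc (suc (suc k))) =
  All.++⁺ (level-vertices (suc (suc k)) (suc (suc (suc k))) (n≤1+n _))
          (All.map (λ { (1≤v , v<) → 1≤v , <-≤-trans v< (^-monoʳ-≤ 2 (s≤s (k≤k+3 k))) })
                   (witness-vertices k))

witness-unique : ∀ n → Unique (witness n)
witness-unique zero                = level-unique 0
witness-unique (suc zero)          = level-unique 0
witness-unique (suc (suc zero))    = level-unique 1
witness-unique (suc (suc (suc k))) =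
  Unique.++⁺ (level-unique (suc (suc k))) (witness-unique k) disjoint
  where
  -- witness k lies strictly above level k+2
  disjoint : Disjoint (level (suc (suc k))) (witness k)
  disjoint (v∈level , v∈witness) =
    <⇒≱ (<-≤-trans (proj₂ (lookup (witness-vertices k) v∈witness)) (^-monoʳ-≤ 2 (n≤1+n (suc k))))
        (proj₁ (∈-level⁻ (suc (suc k)) v∈level))

-- Vertices on levels ≥ k+1 of ST_(k+3) are dominated by level k+2, the others by witness k.
witness-dominates : ∀ n → Dominates n (witness n)
witness-dominates zero v (1≤v , v<2) =
  level-dominates 0 0 z≤n (1≤v , v<2) (≤-trans 1≤v (m≤m+n v _)) (<-≤-trans v<2 (s≤s (s≤s z≤n)))
witness-dominates (suc zero) v (1≤v , v<4) =
  level-dominates 1 0 z≤n (1≤v , v<4) (≤-trans 1≤v (m≤m+n v _)) v<4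
witness-dominates (suc (suc zero)) v (1≤v , v<8) =
  level-dominates 2 1 (s≤s z≤n) (1≤v , v<8) (*-monoʳ-≤ 2 1≤v) v<8
witness-dominates (suc (suc (suc k))) v (1≤v , v<) with 2 ^ suc k ≤? v
... | yes on-or-below =
  Dominated-mono ≤-refl ∈-++⁺ˡ
    (level-dominates (suc (suc (suc k))) (suc (suc k)) (n≤1+n _) (1≤v , v<) (*-monoʳ-≤ 2 on-or-below) v<)
... | no above =
  Dominated-mono (k≤k+3 k) (∈-++⁺ʳ (level (suc (suc k)))) (witness-dominates k v (1≤v , ≰⇒> above))

γ-is-domination-number : ∀ n → DominationNumber n (γ n)
γ-is-domination-number n =
  (witness n , (witness-vertices n , witness-dominates n) , witness-unique n , witness-length n) ,
  (λ S dom _ → γ-lower n S (proj₂ dom))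

offset : ℕ → ℕ
offset zero       = 0
offset (suc zero) = 1 + 3
offset _          = 2 + 3

%3-periodic : ∀ k → suc (suc (suc k)) % 3 ≡ k % 3
%3-periodic k = trans (cong (_% 3) (+-comm 3 k)) ([m+n]%n≡m%n k 3)

-- Induction along the recurrence: 7·(2^(k+2) + γ k) + c = 7·2^(k+2) + 2^(k+2) + 3 = 2^(k+5) + 3.
γ-identity : ∀ n → 7 * γ n + offset (n % 3) ≡ 2 ^ (n + 2) + 3
γ-identity zero             = refl
γ-identity (suc zero)       = refl
γ-identity (suc (suc zero)) = refl
γ-identity (suc (suc (suc k))) = begin
  7 * (2 ^ suc (suc k) + γ k) + offset (suc (suc (suc k)) % 3)
    ≡⟨ cong₂ (λ p r → 7 * (p + γ k) + offset r) (cong (2 ^_) (+-comm 2 k)) (%3-periodic k) ⟩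
  7 * (P + γ k) + offset (k % 3)       ≡⟨ distribute P (γ k) (offset (k % 3)) ⟩
  7 * P + (7 * γ k + offset (k % 3))   ≡⟨ cong (7 * P +_) (γ-identity k) ⟩
  7 * P + (P + 3)                      ≡⟨ octuple P ⟩
  2 * (2 * (2 * P)) + 3                ∎
  where
  open ≡-Reasoning
  P = 2 ^ (k + 2)
  distribute : ∀ p g c → 7 * (p + g) + c ≡ 7 * p + (7 * g + c)
  distribute = solve-∀
  octuple : ∀ p → 7 * p + (p + 3) ≡ 2 * (2 * (2 * p)) + 3
  octuple = solve-∀

cancel-3 : ∀ {a b} c → a + (c + 3) ≡ b + 3 → a + c ≡ b
cancel-3 {a} c e = +-cancelʳ-≡ 3 _ _ (trans (+-assoc a c 3) e)

γ-closed-form : ∀ n →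
  (n % 3 ≡ 0 → 7 * γ n ≡ 2 ^ (n + 2) + 3) ×
  (n % 3 ≡ 1 → 7 * γ n ≡ 2 ^ (n + 2) ∸ 1) ×
  (n % 3 ≡ 2 → 7 * γ n ≡ 2 * (2 ^ (n + 1) ∸ 1))
γ-closed-form n = residue-0 , residue-1 , residue-2
  where
  open ≡-Reasoning
  g = 7 * γ n
  identity-at : ∀ {r} → n % 3 ≡ r → g + offset r ≡ 2 ^ (n + 2) + 3
  identity-at e = subst (λ r → g + offset r ≡ 2 ^ (n + 2) + 3) e (γ-identity n)
  residue-0 : n % 3 ≡ 0 → g ≡ 2 ^ (n + 2) + 3
  residue-0 e = trans (sym (+-identityʳ g)) (identity-at e)
  residue-1 : n % 3 ≡ 1 → g ≡ 2 ^ (n + 2) ∸ 1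
  residue-1 e = begin
    g                    ≡⟨ sym (m+n∸n≡m g 1) ⟩
    g + 1 ∸ 1            ≡⟨ cong (_∸ 1) (cancel-3 1 (identity-at e)) ⟩
    2 ^ (n + 2) ∸ 1      ∎
  residue-2 : n % 3 ≡ 2 → g ≡ 2 * (2 ^ (n + 1) ∸ 1)
  residue-2 e = begin
    g                    ≡⟨ sym (m+n∸n≡m g 2) ⟩
    g + 2 ∸ 2            ≡⟨ cong (_∸ 2) (cancel-3 2 (identity-at e)) ⟩
    2 ^ (n + 2) ∸ 2      ≡⟨ cong (λ m → 2 ^ m ∸ 2) (+-suc n 1) ⟩
    2 * 2 ^ (n + 1) ∸ 2  ≡⟨ sym (*-distribˡ-∸ 2 (2 ^ (n + 1)) 1) ⟩
    2 * (2 ^ (n + 1) ∸ 1) ∎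

theorem5 : ∀ n → 1 ≤ n → ∃ λ g → DominationNumber n g ×
    ((n % 3 ≡ 0 → 7 * g ≡ 2 ^ (n + 2) + 3) ×
     (n % 3 ≡ 1 → 7 * g ≡ 2 ^ (n + 2) ∸ 1) ×
     (n % 3 ≡ 2 → 7 * g ≡ 2 * (2 ^ (n + 1) ∸ 1)))
theorem5 n _ = γ n , γ-is-domination-number n , γ-closed-form n
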